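{- Let $G=(V,E)$ be a connected proper chordal graph and $(T,r,\rho)$ an indifference tree-layout of $G$. Then the set $\mathcal{B}$ of inclusion-maximal members of $\{B(x): x\in V\}$ is a partition of $V$.
   Context: A tree-layout of $G=(V,E)$ is a triple $(T,r,\rho)$ with $T$ a tree on $|V|$ nodes rooted at $r$ and $\rho:V\to V(T)$ a bijection such that for every edge $xy$, $\rho(x)$ is an ancestor of $\rho(y)$ or vice versa. Write $u\prec v$ if $\rho(u)$ is a proper ancestor of $\rho(v)$; $A(v)=\{u:u\prec v\}$. $G$ is proper chordal if it admits a tree-layout with no $x\prec y\prec z$ such that $xz\in E$ and exactly one of $xy,yz$ is in $E$. An indifference tree-layout is a tree-layout with no $x\prec y\prec z$ such that $xz\in E$ and ($xy\notin E$ or $yz\notin E$). For $S\subseteq V$, $N(S)$ is the set of vertices outside $S$ with a neighbour in $S$. For nonempty $S$ and a connected component $C$ of $G-S$, a vertex $v\in C$ is $S$-maximal if $N(w)\cap S\subseteq N(v)\cap S$ for every $w\in C$; $v$ is $U$-universal if $v$ is adjacent to every vertex of $U\setminus\{v\}$. The $S$-block of $C$ is the set of vertices of $C$ that are $S$-maximal and $(N(S)\cap C)$-universal. For $x\ne\rho^{ -1}(r)$, $B(x)$ is the $A(x)$-block of the component of $G-A(x)$ containing $x$; for the root vertex $x=\rho^{ -1}(r)$, $B(x)=\{x\}$. -}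

module Defs where

open import Data.Nat using (ℕ)
open import Data.Fin using (Fin)
open import Data.Maybe using (Maybe; just; nothing)
open import Data.Product using (Σ; _×_; ∃; ∃-syntax)
open import Data.Sum using (_⊎_)
open import Relation.Nullary using (¬_)
open import Relation.Binary using (Decidable)
open import Relation.Binary.PropositionalEquality using (_≡_; _≢_)
open import Function.Definitions using (Bijective)

record Graph (n : ℕ) : Set₁ where
  field
    E     : Fin n → Fin n → Set
    E?    : Decidable E
    sym   : ∀ {x y} → E x y → E y x
    irrefl : ∀ {x} → ¬ E x x
open Graph public

Subset : ℕ → Set₁
Subset n = Fin n → Set

_⊆_ : ∀ {n} → Subset n → Subset n → Set
S ⊆ T = ∀ v → S v → T v

data ReachIn {n} (G : Graph n) (P : Subset n) : Fin n → Fin n → Set where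
  here : ∀ {u} → P u → ReachIn G P u u
  step : ∀ {u v w} → P u → E G u v → ReachIn G P v w → ReachIn G P u w

Connected : ∀ {n} → Graph n → Set
Connected {n} G = ∀ u w → ReachIn G (λ _ → Fin n) u w

data ProperAnc {n} (par : Fin n → Maybe (Fin n)) : Fin n → Fin n → Set where
  one  : ∀ {a b} → par b ≡ just a → ProperAnc par a b
  more : ∀ {a b c} → ProperAnc par a b → par c ≡ just b → ProperAnc par a c

record RootedTree (n : ℕ) : Set where
  field
    parent     : Fin n → Maybe (Fin n)
    root       : Fin n
    root-top   : parent root ≡ nothing
    nonroot    : ∀ v → v ≢ root → Σ (Fin n) (λ p → parent v ≡ just p)
    acyclic    : ∀ v → ¬ ProperAnc parent v v
open RootedTree public

record TreeLayout {n} (G : Graph n) : Set where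
  field
    tree   : RootedTree n
    ρ      : Fin n → Fin n
    ρ-bij  : Bijective _≡_ _≡_ ρ
    -- edges join ancestor/descendant pairs (proper, since G has no loops)
    edges  : ∀ x y → E G x y →
             ProperAnc (parent tree) (ρ x) (ρ y) ⊎ ProperAnc (parent tree) (ρ y) (ρ x)
open TreeLayout public

_≺[_]_ : ∀ {n} {G : Graph n} → Fin n → TreeLayout G → Fin n → Set
u ≺[ L ] v = ProperAnc (parent (tree L)) (ρ L u) (ρ L v)

ExactlyOne : Set → Set → Set
ExactlyOne P Q = (P × ¬ Q) ⊎ (¬ P × Q)

IsProperChordalLayout : ∀ {n} {G : Graph n} → TreeLayout G → Set
IsProperChordalLayout {n} {G} L =
  ∀ (x y z : Fin n) → x ≺[ L ] y → y ≺[ L ] z → E G x z → ¬ ExactlyOne (E G x y) (E G y z)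

ProperChordal : ∀ {n} → Graph n → Set
ProperChordal G = ∃[ L ] IsProperChordalLayout {G = G} L

IsIndifferenceLayout : ∀ {n} {G : Graph n} → TreeLayout G → Set
IsIndifferenceLayout {n} {G} L =
  ∀ (x y z : Fin n) → x ≺[ L ] y → y ≺[ L ] z → E G x z → ¬ (¬ E G x y ⊎ ¬ E G y z)

module _ {n} (G : Graph n) where

  Nbhd : Subset n → Subset n
  Nbhd S v = ¬ S v × ∃[ s ] (S s × E G v s)

  Comp : Subset n → Fin n → Subset n
  Comp S x w = ReachIn G (λ u → ¬ S u) x w

  -- S-block of the component C of G - S (C given as Comp S x)
  Block : Subset n → Subset n → Subset n
  Block S C v =
    C v
    × (∀ w → C w → ∀ s → S s → E G w s → E G v s)
    × (∀ u → Nbhd S u → C u → u ≢ v → E G v u)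

module _ {n} {G : Graph n} (L : TreeLayout G) where

  Anc : Fin n → Subset n
  Anc v u = u ≺[ L ] v

  B : Fin n → Subset n
  B x v = (ρ L x ≡ root (tree L) × v ≡ x)
        ⊎ (ρ L x ≢ root (tree L) × Block G (Anc x) (Comp G (Anc x) x) v)

  MaximalB : Fin n → Set
  MaximalB x = ∀ y → B x ⊆ B y → B y ⊆ B x

  MaximalBlocksPartition : Set
  MaximalBlocksPartition =
      (∀ x → MaximalB x → ∃[ v ] B x v)
    × (∀ v → ∃[ x ] (MaximalB x × B x v))
    × (∀ x y → MaximalB x → MaximalB y → ∃[ v ] (B x v × B y v) → B x ⊆ B y × B y ⊆ B x)

-- Every vertex x lies in B(x), and B(x) consists of descendants of x. Indifference
-- makes blocks transitive (v ∈ B(x) gives B(v) ⊆ B(x)) and convex along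
-- root-to-leaf paths (x ≺ y ≼ v with v ∈ B(x) gives y ∈ B(x)). By transitivity,
-- B(x) is maximal exactly when x lies in no block other than its own; descending
-- to ancestors, every vertex lies in such a block, and by convexity two such
-- blocks sharing a vertex have comparable tops, one lying in the other's block,
-- so they coincide.
module Submission where

open import Data.Nat using (ℕ)
open import Data.Fin using (Fin; _≟_)
open import Data.Fin.Properties using (all?; any?)
open import Data.Fin.Induction using (spo-wellFounded)
open import Data.Maybe using (Maybe; just; nothing)
open import Data.Maybe.Properties using (just-injective)
open import Data.Product using (_×_; _,_; proj₁; proj₂; ∃; ∃-syntax)
open import Data.Sum using (_⊎_; inj₁; inj₂; [_,_])
open import Data.Empty using (⊥-elim)
open import Function using (id)
open import Relation.Nullary using (¬_; Dec; yes; no)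
open import Relation.Nullary.Decidable using (_×-dec_; _⊎-dec_; _→-dec_; ¬?)
open import Relation.Binary using (IsStrictPartialOrder; Decidable)
open import Relation.Binary.PropositionalEquality
  using (_≡_; _≢_; refl; cong; subst; isEquivalence)
  renaming (sym to ≡-sym; trans to ≡-trans)
open import Induction.WellFounded using (Acc; acc; WellFounded)
import Relation.Binary.Construct.On as On
open import Defs

module _ {n : ℕ} {par : Fin n → Maybe (Fin n)} where

  ProperAnc-trans : ∀ {a b c} → ProperAnc par a b → ProperAnc par b c → ProperAnc par a c
  ProperAnc-trans ab (one e)     = more ab e
  ProperAnc-trans ab (more bc e) = more (ProperAnc-trans ab bc) e

  ¬ProperAnc-orphan : ∀ {a b} → par b ≡ nothing → ¬ ProperAnc par a b
  ¬ProperAnc-orphan b-orphan (one e) with ≡-trans (≡-sym b-orphan) e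
  ... | ()
  ¬ProperAnc-orphan b-orphan (more _ e) with ≡-trans (≡-sym b-orphan) e
  ... | ()

  ProperAnc-viaParent : ∀ {a b c} → ProperAnc par a b → par b ≡ just c →
                        a ≡ c ⊎ ProperAnc par a c
  ProperAnc-viaParent (one e) e′ = inj₁ (just-injective (≡-trans (≡-sym e) e′))
  ProperAnc-viaParent (more ab e) e′ with just-injective (≡-trans (≡-sym e) e′)
  ... | refl = inj₂ ab

  ProperAnc-linear : ∀ {a b c} → ProperAnc par a c → ProperAnc par b c →
                     a ≡ b ⊎ ProperAnc par a b ⊎ ProperAnc par b a
  ProperAnc-linear (one e) bc with ProperAnc-viaParent bc e
  ... | inj₁ refl = inj₁ refl
  ... | inj₂ ba   = inj₂ (inj₂ ba)
  ProperAnc-linear (more ad e) bc with ProperAnc-viaParent bc e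
  ... | inj₁ refl = inj₂ (inj₁ ad)
  ... | inj₂ bd   = ProperAnc-linear ad bd

module RootedTreeProperties {n : ℕ} (T : RootedTree n) where

  _<_ : Fin n → Fin n → Set
  _<_ = ProperAnc (parent T)

  ¬<-root : ∀ {a} → ¬ a < root T
  ¬<-root = ¬ProperAnc-orphan (root-top T)

  <-isStrictPartialOrder : IsStrictPartialOrder _≡_ _<_
  <-isStrictPartialOrder = record
    { isEquivalence = isEquivalence
    ; irrefl        = λ { refl → acyclic T _ }
    ; trans         = ProperAnc-trans
    ; <-resp-≈      = (λ { refl p → p }) , (λ { refl p → p })
    }

  <-wellFounded : WellFounded _<_
  <-wellFounded = spo-wellFounded <-isStrictPartialOrder

  private
    <?-acc : ∀ a b → Acc _<_ b → Dec (a < b)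
    <?-acc a b (acc below) with parent T b in e
    ... | nothing = no (¬ProperAnc-orphan e)
    ... | just c with a ≟ c
    ...   | yes refl = yes (one e)
    ...   | no a≢c with <?-acc a c (below (one e))
    ...     | yes a<c = yes (more a<c e)
    ...     | no a≮c  = no λ a<b → [ a≢c , a≮c ] (ProperAnc-viaParent a<b e)

  _<?_ : Decidable _<_
  a <? b = <?-acc a b (<-wellFounded b)

module _ {n : ℕ} {G : Graph n} where

  ReachIn-source : ∀ {P : Subset n} {a b} → ReachIn G P a b → P a
  ReachIn-source (here p)     = p
  ReachIn-source (step p _ _) = p

  ReachIn-++ : ∀ {P : Subset n} {a b c} → ReachIn G P a b → ReachIn G P b c → ReachIn G P a c
  ReachIn-++ (here _)     r = r
  ReachIn-++ (step p e q) r = step p e (ReachIn-++ q r)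

  ReachIn-mono : ∀ {P Q : Subset n} {a b} → P ⊆ Q → ReachIn G P a b → ReachIn G Q a b
  ReachIn-mono P⊆Q (here p)     = here (P⊆Q _ p)
  ReachIn-mono P⊆Q (step p e r) = step (P⊆Q _ p) e (ReachIn-mono P⊆Q r)

module LayoutProperties {n : ℕ} {G : Graph n} (L : TreeLayout G) where

  open RootedTreeProperties (tree L) using (_<?_; <-wellFounded; ¬<-root)

  _≺_ : Fin n → Fin n → Set
  u ≺ v = u ≺[ L ] v

  _≼_ : Fin n → Fin n → Set
  u ≼ v = u ≡ v ⊎ u ≺ v

  ≺-trans : ∀ {a b c} → a ≺ b → b ≺ c → a ≺ c
  ≺-trans = ProperAnc-trans

  ≺-irrefl : ∀ {a} → ¬ a ≺ a
  ≺-irrefl = acyclic (tree L) _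

  ≺-linear : ∀ {a b c} → a ≺ c → b ≺ c → a ≡ b ⊎ a ≺ b ⊎ b ≺ a
  ≺-linear a≺c b≺c with ProperAnc-linear a≺c b≺c
  ... | inj₁ ρa≡ρb = inj₁ (proj₁ (ρ-bij L) ρa≡ρb)
  ... | inj₂ r     = inj₂ r

  ≼-linear : ∀ {a b c} → a ≼ c → b ≼ c → a ≡ b ⊎ a ≺ b ⊎ b ≺ a
  ≼-linear (inj₁ refl) (inj₁ refl) = inj₁ refl
  ≼-linear (inj₁ refl) (inj₂ b≺a)  = inj₂ (inj₂ b≺a)
  ≼-linear (inj₂ a≺b)  (inj₁ refl) = inj₂ (inj₁ a≺b)
  ≼-linear (inj₂ a≺c)  (inj₂ b≺c)  = ≺-linear a≺c b≺c

  ≼-≺-trans : ∀ {a b c} → a ≼ b → b ≺ c → a ≺ c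
  ≼-≺-trans (inj₁ refl) b≺c = b≺c
  ≼-≺-trans (inj₂ a≺b)  b≺c = ≺-trans a≺b b≺c

  ≺-≼-trans : ∀ {a b c} → a ≺ b → b ≼ c → a ≺ c
  ≺-≼-trans a≺b (inj₁ refl) = a≺b
  ≺-≼-trans a≺b (inj₂ b≺c)  = ≺-trans a≺b b≺c

  ≼-antisym : ∀ {a b} → a ≼ b → b ≼ a → a ≡ b
  ≼-antisym (inj₁ a≡b) _          = a≡b
  ≼-antisym (inj₂ _)   (inj₁ b≡a) = ≡-sym b≡a
  ≼-antisym (inj₂ a≺b) (inj₂ b≺a) = ⊥-elim (≺-irrefl (≺-trans a≺b b≺a))

  ≺-wellFounded : WellFounded _≺_
  ≺-wellFounded = On.wellFounded (ρ L) <-wellFounded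

  _≺?_ : Decidable _≺_
  a ≺? b = ρ L a <? ρ L b

  _≼?_ : Decidable _≼_
  a ≼? b = (a ≟ b) ⊎-dec (a ≺? b)

  ¬≺-root : ∀ {x y} → ρ L x ≡ root (tree L) → ¬ y ≺ x
  ¬≺-root {x} {y} x-root y≺x = ¬<-root (subst (ProperAnc (parent (tree L)) (ρ L y)) x-root y≺x)

  ¬Anc-below : ∀ {x w} → x ≺ w → ¬ Anc L x w
  ¬Anc-below x≺w w≺x = ≺-irrefl (≺-trans x≺w w≺x)

  -- An edge leaving the descendants of x ends at an ancestor of x, which G - A(x) lacks.
  reach-avoiding-ancestors-stays-below : ∀ {x a w} → ReachIn G (λ u → ¬ Anc L x u) a w →
                                         x ≼ a → x ≼ w
  reach-avoiding-ancestors-stays-below (here _) x≼a = x≼a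
  reach-avoiding-ancestors-stays-below {x} (step {u} {v} _ e r) x≼u with edges L u v e
  ... | inj₁ u≺v = reach-avoiding-ancestors-stays-below r (inj₂ (≼-≺-trans x≼u u≺v))
  ... | inj₂ v≺u with x≼u
  ...   | inj₁ refl = ⊥-elim (ReachIn-source r v≺u)
  ...   | inj₂ x≺u with ≺-linear v≺u x≺u
  ...     | inj₁ refl       = reach-avoiding-ancestors-stays-below r (inj₁ refl)
  ...     | inj₂ (inj₁ v≺x) = ⊥-elim (ReachIn-source r v≺x)
  ...     | inj₂ (inj₂ x≺v) = reach-avoiding-ancestors-stays-below r (inj₂ x≺v)

  Comp⇒≽ : ∀ {x w} → Comp G (Anc L x) x w → x ≼ w
  Comp⇒≽ c = reach-avoiding-ancestors-stays-below c (inj₁ refl)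

  Comp-self : ∀ x → Comp G (Anc L x) x x
  Comp-self x = here ≺-irrefl

  Comp-adjacent-descendant : ∀ {x w} → x ≺ w → E G x w → Comp G (Anc L x) x w
  Comp-adjacent-descendant x≺w e = step ≺-irrefl e (here (¬Anc-below x≺w))

  path-escaping-descendants : ∀ {x a w} → ReachIn G (λ _ → Fin n) a w → x ≼ a → w ≺ x →
                              ∃ λ u → ∃ λ s → x ≼ u × s ≺ x × E G u s
  path-escaping-descendants (here _) x≼w w≺x = ⊥-elim (≺-irrefl (≼-≺-trans x≼w w≺x))
  path-escaping-descendants {x} (step {u} {v} _ e r) x≼u w≺x with edges L u v e
  ... | inj₁ u≺v = path-escaping-descendants r (inj₂ (≼-≺-trans x≼u u≺v)) w≺x
  ... | inj₂ v≺u with x≼u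
  ...   | inj₁ refl = u , v , inj₁ refl , v≺u , e
  ...   | inj₂ x≺u with ≺-linear v≺u x≺u
  ...     | inj₁ refl       = path-escaping-descendants r (inj₁ refl) w≺x
  ...     | inj₂ (inj₁ v≺x) = u , v , x≼u , v≺x , e
  ...     | inj₂ (inj₂ x≺v) = path-escaping-descendants r (inj₂ x≺v) w≺x

  BlockOf : Fin n → Subset n
  BlockOf x = Block G (Anc L x) (Comp G (Anc L x) x)

  B⇒≽ : ∀ {x v} → B L x v → x ≼ v
  B⇒≽ (inj₁ (_ , refl))  = inj₁ refl
  B⇒≽ (inj₂ (_ , c , _)) = Comp⇒≽ c

module IndifferenceLayoutProperties {n : ℕ} {G : Graph n} (L : TreeLayout G)
                                    (ind : IsIndifferenceLayout L) where

  open LayoutProperties L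

  indifference : ∀ {x y z} → x ≺ y → y ≺ z → E G x z → E G x y × E G y z
  indifference {x} {y} {z} x≺y y≺z xz with E? G x y | E? G y z
  ... | yes xy | yes yz = xy , yz
  ... | no ¬xy | _      = ⊥-elim (ind x y z x≺y y≺z xz (inj₁ ¬xy))
  ... | yes _  | no ¬yz = ⊥-elim (ind x y z x≺y y≺z xz (inj₂ ¬yz))

  spanning-edge⇒edge-to-top : ∀ {s x w} → s ≺ x → x ≺ w → E G w s → E G x s
  spanning-edge⇒edge-to-top s≺x x≺w ws = sym G (proj₁ (indifference s≺x x≺w (sym G ws)))

  Block-self : ∀ x → BlockOf x x
  Block-self x = Comp-self x , maximal , universal
    where
    maximal : ∀ w → Comp G (Anc L x) x w → ∀ s → Anc L x s → E G w s → E G x s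
    maximal w c s s≺x ws with Comp⇒≽ c
    ... | inj₁ refl = ws
    ... | inj₂ x≺w  = spanning-edge⇒edge-to-top s≺x x≺w ws
    universal : ∀ u → Nbhd G (Anc L x) u → Comp G (Anc L x) x u → u ≢ x → E G x u
    universal u (_ , s , s≺x , us) c u≢x with Comp⇒≽ c
    ... | inj₁ refl = ⊥-elim (u≢x refl)
    ... | inj₂ x≺u  = proj₂ (indifference s≺x x≺u (sym G us))

  B-self : ∀ x → B L x x
  B-self x with ρ L x ≟ root (tree L)
  ... | yes x-root = inj₁ (x-root , refl)
  ... | no ¬x-root = inj₂ (¬x-root , Block-self x)

  Block-trans : ∀ {x v t} → x ≺ v → BlockOf x v → BlockOf v t → BlockOf x t
  Block-trans {x} {v} {t} x≺v (cv , maxv , univv) (ct , maxt , univt) =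
    ReachIn-++ cv (ReachIn-mono (λ a a⊀v a≺x → a⊀v (≺-trans a≺x x≺v)) ct) , maximal , universal
    where
    maxt-v : ∀ {s} → s ≺ v → E G v s → E G t s
    maxt-v {s} s≺v vs = maxt v (Comp-self v) s s≺v vs
    maximal : ∀ w → Comp G (Anc L x) x w → ∀ s → Anc L x s → E G w s → E G t s
    maximal w cw s s≺x ws = maxt-v (≺-trans s≺x x≺v) (maxv w cw s s≺x ws)
    universal : ∀ u → Nbhd G (Anc L x) u → Comp G (Anc L x) x u → u ≢ t → E G t u
    universal u nu@(_ , s , s≺x , us) cu u≢t with u ≟ v
    ... | yes refl with Comp⇒≽ ct
    ...   | inj₁ refl = ⊥-elim (u≢t refl)
    ...   | inj₂ v≺t  =
            sym G (proj₂ (indifference (≺-trans s≺x x≺v) v≺t (sym G (maxt-v (≺-trans s≺x x≺v) us))))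
    universal u nu@(_ , s , s≺x , us) cu u≢t | no u≢v with edges L v u (univv u nu cu u≢v)
    ... | inj₁ v≺u = univt u (¬Anc-below v≺u , s , ≺-trans s≺x x≺v , us)
                             (Comp-adjacent-descendant v≺u (univv u nu cu u≢v)) u≢t
    ... | inj₂ u≺v = maxt-v u≺v (univv u nu cu u≢v)

  B-trans : ∀ {x v t} → B L x v → B L v t → B L x t
  B-trans (inj₁ (_ , refl)) bvt = bvt
  B-trans bxv@(inj₂ (¬x-root , bxv′)) bvt with B⇒≽ bxv | bvt
  ... | inj₁ refl | _                 = bvt
  ... | inj₂ x≺v  | inj₁ (v-root , _) = ⊥-elim (¬≺-root v-root x≺v)
  ... | inj₂ x≺v  | inj₂ (_ , bvt′)   = inj₂ (¬x-root , Block-trans x≺v bxv′ bvt′)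

module ConnectedIndifferenceLayoutProperties {n : ℕ} {G : Graph n} (conn : Connected G)
                                             (L : TreeLayout G) (ind : IsIndifferenceLayout L) where

  open LayoutProperties L
  open IndifferenceLayoutProperties L ind

  ancestor-neighbour : ∀ x → ρ L x ≢ root (tree L) → ∃ λ s → s ≺ x × E G x s
  ancestor-neighbour x ¬x-root with nonroot (tree L) (ρ L x) ¬x-root
  ... | p , ρx↑p with proj₂ (ρ-bij L) p
  ...   | y , ρy≡p with path-escaping-descendants (conn x y) (inj₁ refl)
                         (one (≡-trans ρx↑p (cong just (≡-sym (ρy≡p refl)))))
  ...     | _ , s , inj₁ refl , s≺x , xs = s , s≺x , xs
  ...     | _ , s , inj₂ x≺u  , s≺x , us = s , s≺x , spanning-edge⇒edge-to-top s≺x x≺u us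

  B-convex : ∀ {x y v} → x ≺ y → y ≼ v → B L x v → B L x y
  B-convex x≺y y≼v (inj₁ (_ , refl)) = ⊥-elim (≺-irrefl (≺-≼-trans x≺y y≼v))
  B-convex x≺y (inj₁ refl) bxv = bxv
  B-convex {x} {y} {v} x≺y (inj₂ y≺v) (inj₂ (¬x-root , cv , maxv , univv)) =
    inj₂ (¬x-root , Comp-adjacent-descendant x≺y xy , maximal , universal)
    where
    s₀ = proj₁ (ancestor-neighbour x ¬x-root)
    s₀≺x = proj₁ (proj₂ (ancestor-neighbour x ¬x-root))
    s₀y×yv : E G s₀ y × E G y v
    s₀y×yv = indifference (≺-trans s₀≺x x≺y) y≺v
               (sym G (maxv x (Comp-self x) s₀ s₀≺x (proj₂ (proj₂ (ancestor-neighbour x ¬x-root)))))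
    xy : E G x y
    xy = proj₂ (indifference s₀≺x x≺y (proj₁ s₀y×yv))
    maximal : ∀ w → Comp G (Anc L x) x w → ∀ s → Anc L x s → E G w s → E G y s
    maximal w cw s s≺x ws = spanning-edge⇒edge-to-top (≺-trans s≺x x≺y) y≺v (maxv w cw s s≺x ws)
    universal : ∀ u → Nbhd G (Anc L x) u → Comp G (Anc L x) x u → u ≢ y → E G y u
    universal u nu@(_ , s , s≺x , us) cu u≢y with u ≟ v
    ... | yes refl = proj₂ s₀y×yv
    ... | no u≢v with edges L v u (univv u nu cu u≢v)
    ...   | inj₁ v≺u = proj₂ (indifference (≺-trans s≺x x≺y) (≺-trans y≺v v≺u) (sym G us))
    ...   | inj₂ u≺v with ≺-linear u≺v y≺v
    ...     | inj₁ refl       = ⊥-elim (u≢y refl)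
    ...     | inj₂ (inj₁ u≺y) = spanning-edge⇒edge-to-top u≺y y≺v (univv u nu cu u≢v)
    ...     | inj₂ (inj₂ y≺u) = proj₁ (indifference y≺u u≺v (proj₂ s₀y×yv))

  -- The block B(z) of a non-root z, described by ancestry instead of components of G - A(z);
  -- this makes membership decidable.
  LocalBlock : Fin n → Fin n → Set
  LocalBlock z y = (y ≡ z ⊎ (z ≺ y × E G z y))
                 × (∀ s → s ≺ z → E G z s → E G y s)
                 × (∀ u → z ≼ u → (∃ λ s → s ≺ z × E G u s) → u ≢ y → E G y u)

  LocalBlock? : Decidable LocalBlock
  LocalBlock? z y =
    ((y ≟ z) ⊎-dec (z ≺? y ×-dec E? G z y))
    ×-dec all? (λ s → s ≺? z →-dec (E? G z s →-dec E? G y s))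
    ×-dec all? (λ u → z ≼? u →-dec
                        (any? (λ s → s ≺? z ×-dec E? G u s) →-dec (¬? (u ≟ y) →-dec E? G y u)))

  Block⇒LocalBlock : ∀ {z y} → ρ L z ≢ root (tree L) → BlockOf z y → LocalBlock z y
  Block⇒LocalBlock {z} {y} ¬z-root (cy , maxy , univy) = near , maximal , universal
    where
    maximal : ∀ s → s ≺ z → E G z s → E G y s
    maximal s s≺z zs = maxy z (Comp-self z) s s≺z zs
    near : y ≡ z ⊎ (z ≺ y × E G z y)
    near with Comp⇒≽ cy | ancestor-neighbour z ¬z-root
    ... | inj₁ z≡y | _            = inj₁ (≡-sym z≡y)
    ... | inj₂ z≺y | s , s≺z , zs = inj₂ (z≺y , proj₂ (indifference s≺z z≺y (sym G (maximal s s≺z zs))))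
    universal : ∀ u → z ≼ u → (∃ λ s → s ≺ z × E G u s) → u ≢ y → E G y u
    universal u (inj₁ refl) (s , s≺z , us) u≢y = univy u (≺-irrefl , s , s≺z , us) (Comp-self z) u≢y
    universal u (inj₂ z≺u) (s , s≺z , us) u≢y =
      univy u (¬Anc-below z≺u , s , s≺z , us)
              (Comp-adjacent-descendant z≺u (proj₂ (indifference s≺z z≺u (sym G us)))) u≢y

  LocalBlock⇒Block : ∀ {z y} → LocalBlock z y → BlockOf z y
  LocalBlock⇒Block {z} {y} (near , maxy , univy) = comp near , maximal , universal
    where
    comp : y ≡ z ⊎ (z ≺ y × E G z y) → Comp G (Anc L z) z y
    comp (inj₁ refl)       = Comp-self z
    comp (inj₂ (z≺y , zy)) = Comp-adjacent-descendant z≺y zy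
    maximal : ∀ w → Comp G (Anc L z) z w → ∀ s → Anc L z s → E G w s → E G y s
    maximal w cw s s≺z ws with Comp⇒≽ cw
    ... | inj₁ refl = maxy s s≺z ws
    ... | inj₂ z≺w  = maxy s s≺z (spanning-edge⇒edge-to-top s≺z z≺w ws)
    universal : ∀ u → Nbhd G (Anc L z) u → Comp G (Anc L z) z u → u ≢ y → E G y u
    universal u (_ , s , s≺z , us) cu u≢y = univy u (Comp⇒≽ cu) (s , s≺z , us) u≢y

  B? : Decidable (B L)
  B? z y with ρ L z ≟ root (tree L)
  ... | yes z-root with y ≟ z
  ...   | yes y≡z = yes (inj₁ (z-root , y≡z))
  ...   | no  y≢z = no λ { (inj₁ (_ , y≡z)) → y≢z y≡z ; (inj₂ (¬z-root , _)) → ¬z-root z-root }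
  B? z y | no ¬z-root with LocalBlock? z y
  ...   | yes local  = yes (inj₂ (¬z-root , LocalBlock⇒Block local))
  ...   | no ¬local  = no λ { (inj₁ (z-root , _)) → ¬z-root z-root
                            ; (inj₂ (_ , bzy))    → ¬local (Block⇒LocalBlock ¬z-root bzy) }

  BlockTop : Fin n → Set
  BlockTop x = ∀ z → B L z x → z ≡ x

  MaximalB⇒BlockTop : ∀ {x} → MaximalB L x → BlockTop x
  MaximalB⇒BlockTop {x} max-x z bzx =
    ≡-sym (≼-antisym (B⇒≽ (max-x z (λ _ → B-trans bzx) z (B-self z))) (B⇒≽ bzx))

  BlockTop⇒MaximalB : ∀ {x} → BlockTop x → MaximalB L x
  BlockTop⇒MaximalB top-x y Bx⊆By with top-x y (Bx⊆By _ (B-self _))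
  ... | refl = λ _ → id

  private
    maximal-B-above : ∀ {v y} → Acc _≺_ y → B L y v → ∃ λ x → MaximalB L x × B L x v
    maximal-B-above {v} {y} (acc below) byv with any? (λ z → ¬? (z ≟ y) ×-dec B? z y)
    ... | yes (z , z≢y , bzy) with B⇒≽ bzy
    ...   | inj₁ z≡y = ⊥-elim (z≢y z≡y)
    ...   | inj₂ z≺y = maximal-B-above (below z≺y) (B-trans bzy byv)
    maximal-B-above {v} {y} _ byv | no ¬other = y , BlockTop⇒MaximalB top , byv
      where
      top : BlockTop y
      top z bzy with z ≟ y
      ... | yes z≡y = z≡y
      ... | no z≢y  = ⊥-elim (¬other (z , z≢y , bzy))

  maximal-B-cover : ∀ v → ∃ λ x → MaximalB L x × B L x v
  maximal-B-cover v = maximal-B-above (≺-wellFounded v) (B-self v)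

  maximal-B-overlap⇒≡ : ∀ {x y v} → MaximalB L x → MaximalB L y → B L x v → B L y v → x ≡ y
  maximal-B-overlap⇒≡ max-x max-y bxv byv with ≼-linear (B⇒≽ bxv) (B⇒≽ byv)
  ... | inj₁ x≡y        = x≡y
  ... | inj₂ (inj₁ x≺y) = MaximalB⇒BlockTop max-y _ (B-convex x≺y (B⇒≽ byv) bxv)
  ... | inj₂ (inj₂ y≺x) = ≡-sym (MaximalB⇒BlockTop max-x _ (B-convex y≺x (B⇒≽ bxv) byv))

mainTheorem12 : ∀ {n : ℕ} (G : Graph n) → Connected G → ProperChordal G →
                (L : TreeLayout G) → IsIndifferenceLayout L →
                MaximalBlocksPartition L
mainTheorem12 G conn _ L ind =
  (λ x _ → x , B-self x) , maximal-B-cover , overlap⇒equal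
  where
  open IndifferenceLayoutProperties L ind using (B-self)
  open ConnectedIndifferenceLayoutProperties conn L ind
  overlap⇒equal : ∀ x y → MaximalB L x → MaximalB L y → ∃[ v ] (B L x v × B L y v) →
                  B L x ⊆ B L y × B L y ⊆ B L x
  overlap⇒equal x y max-x max-y (v , bxv , byv) with maximal-B-overlap⇒≡ max-x max-y bxv byv
  ... | refl = (λ _ → id) , (λ _ → id)
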